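{- Let $f:\mathbb{R}_D\to\mathbb{R}_D$ be pointwise continuous, locally nonconstant and equipped with a structure of lifting locators, and let $a<b$ be real numbers equipped with locators such that $f(a)\leq0\leq f(b)$. Then one can construct $x:\mathbb{R}_D$ with $f(x)=0$, together with a locator for $x$.
   Context: Work in Martin-Löf type theory with propositional truncation, function extensionality and propositional extensionality. A Dedekind real is a pair $x=(L,U)$ of proposition-valued predicates on $\mathbb{Q}$, writing $q<x$ for $q\in L$ and $x<r$ for $r\in U$, which is bounded, rounded, transitive and located ($q<r\Rightarrow\|(q<x)+(x<r)\|$). $\mathbb{R}_D$ is the type of Dedekind reals, with $x<y:=\exists_{q:\mathbb{Q}}x<q<y$, $x\le y:=\neg(y<x)$ and apartness $x\mathrel{\#}y:=(x<y)\lor(y<x)$. $f$ is pointwise continuous if for all $x$: $\forall\varepsilon:\mathbb{Q}_+\exists\delta:\mathbb{Q}_+\forall y.\,|x-y|<\delta\Rightarrow|f(x)-f(y)|<\varepsilon$. $f$ is locally nonconstant if for all $x<y$ and $t:\mathbb{R}_D$ there exists $z$ with $x<z<y$ and $f(z)\mathrel{\#}t$. A locator for $x$ is a function $\prod_{q,r:\mathbb{Q}}(q<r)\to(q<x)+(x<r)$ into the untruncated disjoint sum; $f$ lifts locators if it is equipped with an element of $\prod_{x:\mathbb{R}_D}\operatorname{locator}(x)\to\operatorname{locator}(f(x))$. -}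

module Defs where

open import Level using (Level; _⊔_; Setω) renaming (suc to lsuc; zero to lzero)
open import Data.Product using (Σ; _×_; _,_; proj₁; proj₂)
open import Data.Sum using (_⊎_; inj₁; inj₂)
open import Data.Empty using (⊥)
open import Relation.Nullary using (¬_)
open import Relation.Binary using (tri<; tri≈; tri>)
open import Relation.Binary.PropositionalEquality using (_≡_; refl)
open import Data.Rational as ℚ using (ℚ; 0ℚ; 1ℚ) renaming (_<_ to _<ℚ_; _-_ to _-ℚ_)
import Data.Rational.Properties as ℚP

isProp : ∀ {ℓ} → Set ℓ → Set ℓ
isProp A = (x y : A) → x ≡ y

FunExt : Setω
FunExt = ∀ {a b : Level} {A : Set a} {B : A → Set b} {f g : (x : A) → B x} →
         ((x : A) → f x ≡ g x) → f ≡ g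

PropExt : Setω
PropExt = ∀ {ℓ : Level} {P Q : Set ℓ} → isProp P → isProp Q →
          (P → Q) → (Q → P) → P ≡ Q

-- Propositional truncation, given as a structure (Agda without cubical /
-- HITs has no built-in truncation; the theorem is stated for any such).
record PropTrunc : Setω where
  field
    ∥_∥    : ∀ {ℓ} → Set ℓ → Set ℓ
    ∣_∣    : ∀ {ℓ} {A : Set ℓ} → A → ∥ A ∥
    squash : ∀ {ℓ} {A : Set ℓ} → isProp ∥ A ∥
    rec    : ∀ {ℓ ℓ'} {A : Set ℓ} {P : Set ℓ'} → isProp P → (A → P) → ∥ A ∥ → P

module Reals (T : PropTrunc) where
  open PropTrunc T public

  ∃∥ : ∀ {a b} (A : Set a) → (A → Set b) → Set (a ⊔ b)
  ∃∥ A P = ∥ Σ A P ∥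

  _∨_ : ∀ {a b} → Set a → Set b → Set (a ⊔ b)
  P ∨ Q = ∥ P ⊎ Q ∥

  record ℝD : Set₁ where
    field
      L : ℚ → Set
      U : ℚ → Set
      L-prop   : ∀ q → isProp (L q)
      U-prop   : ∀ q → isProp (U q)
      L-inh    : ∃∥ ℚ L
      U-inh    : ∃∥ ℚ U
      L-round  : ∀ q → (L q → ∃∥ ℚ (λ r → (q <ℚ r) × L r))
                     × (∃∥ ℚ (λ r → (q <ℚ r) × L r) → L q)
      U-round  : ∀ r → (U r → ∃∥ ℚ (λ q → (q <ℚ r) × U q))
                     × (∃∥ ℚ (λ q → (q <ℚ r) × U q) → U r)
      trans    : ∀ q r → L q → U r → q <ℚ r
      located  : ∀ q r → q <ℚ r → L q ∨ U r
  open ℝD public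

  _<ℚℝ_ : ℚ → ℝD → Set
  q <ℚℝ x = L x q

  _<ℝℚ_ : ℝD → ℚ → Set
  x <ℝℚ r = U x r

  _<ℝ_ : ℝD → ℝD → Set
  x <ℝ y = ∃∥ ℚ (λ q → (x <ℝℚ q) × (q <ℚℝ y))

  _≤ℝ_ : ℝD → ℝD → Set
  x ≤ℝ y = ¬ (y <ℝ x)

  _#_ : ℝD → ℝD → Set
  x # y = (x <ℝ y) ∨ (y <ℝ x)

  0ℝ : ℝD
  0ℝ = record
    { L = λ q → q <ℚ 0ℚ
    ; U = λ r → 0ℚ <ℚ r
    ; L-prop = λ q → ℚP.<-irrelevant
    ; U-prop = λ r → ℚP.<-irrelevant
    ; L-inh = ∣ ℚ.- 1ℚ , ℚP.negative⁻¹ (ℚ.- 1ℚ) ∣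
    ; U-inh = ∣ 1ℚ , ℚP.positive⁻¹ 1ℚ ∣
    ; L-round = λ q → (λ q<0 → let (m , q<m , m<0) = ℚP.<-dense q<0 in ∣ m , q<m , m<0 ∣)
                    , rec ℚP.<-irrelevant (λ { (r , q<r , r<0) → ℚP.<-trans q<r r<0 })
    ; U-round = λ r → (λ 0<r → let (m , 0<m , m<r) = ℚP.<-dense 0<r in ∣ m , m<r , 0<m ∣)
                    , rec ℚP.<-irrelevant (λ { (q , q<r , 0<q) → ℚP.<-trans 0<q q<r })
    ; trans = λ q r q<0 0<r → ℚP.<-trans q<0 0<r
    ; located = λ q r q<r → loc q r q<r
    }
    where
    loc : ∀ q r → q <ℚ r → (q <ℚ 0ℚ) ∨ (0ℚ <ℚ r)
    loc q r q<r with ℚP.<-cmp q 0ℚ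
    ... | tri< a _ _ = ∣ inj₁ a ∣
    ... | tri≈ _ refl _ = ∣ inj₂ q<r ∣
    ... | tri> _ _ c = ∣ inj₂ (ℚP.<-trans c q<r) ∣

  ℚ₊ : Set
  ℚ₊ = Σ ℚ (λ ε → 0ℚ <ℚ ε)

  -- "x - y < δ" for reals x, y and a rational δ, unfolded from the cut
  -- U(x - y) = { q - r | x < q, r < y }.
  _-_<ℚ_ : ℝD → ℝD → ℚ → Set
  x - y <ℚ δ = ∃∥ (ℚ × ℚ) (λ { (q , r) → (x <ℝℚ q) × (r <ℚℝ y) × ((q -ℚ r) <ℚ δ) })

  -- "|x - y| < δ", using |z| = max(z, -z) and -(x - y) = y - x.
  ∣_-_∣<_ : ℝD → ℝD → ℚ → Set
  ∣ x - y ∣< δ = (x - y <ℚ δ) × (y - x <ℚ δ)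

  PointwiseContinuous : (ℝD → ℝD) → Set₁
  PointwiseContinuous f =
    ∀ (x : ℝD) (ε : ℚ₊) → ∃∥ ℚ₊ (λ δ → ∀ (y : ℝD) →
        ∣ x - y ∣< proj₁ δ → ∣ f x - f y ∣< proj₁ ε)

  LocallyNonconstant : (ℝD → ℝD) → Set₁
  LocallyNonconstant f =
    ∀ (x y : ℝD) → x <ℝ y → ∀ (t : ℝD) →
      ∃∥ ℝD (λ z → (x <ℝ z) × (z <ℝ y) × (f z # t))

  Locator : ℝD → Set
  Locator x = ∀ (q r : ℚ) → q <ℚ r → (q <ℚℝ x) ⊎ (x <ℝℚ r)

  LiftsLocators : (ℝD → ℝD) → Set₁
  LiftsLocators f = ∀ (x : ℝD) → Locator x → Locator (f x)

module Submission where

open import Defs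
open import Data.Product using (Σ; _×_; _,_)
open import Relation.Binary.PropositionalEquality using (_≡_)

-- A *bracket* consists of located reals A ≤ B with f A ≤ 0 ≤ f B, enclosed in
-- a rational interval [u , v].  Cut [u , v] into fifths u < p₁ < p₂ < p₃ < p₄ < v.
-- The locators of B and A either show B < p₄ or p₁ < A, and the interval
-- shrinks directly, or they show A < p₂ < p₃ < B.  In the latter case local
-- nonconstancy and continuity make f apart from 0 at some rational
-- q ∈ (p₂ , p₃); the lifted locator of f (q) certifies the sign of f (q)
-- decidably, so a search through an enumeration of ℚ × ℚ computes such a q,
-- which replaces B (if f q > 0) or A (if f q < 0).  The intervals are nested
-- and shrink by 4/5 in each step, so they determine a real x together with a
-- locator; A and B approach x, so by continuity neither f x > 0 nor f x < 0,
-- whence f x = 0.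

module RationalArithmetic where

  open import Data.Nat as ℕ using (ℕ; suc)
  import Data.Nat.Properties as ℕP
  import Data.Nat.Coprimality as Coprime
  import Data.Integer as ℤ
  import Data.Integer.Properties as ℤP
  open import Data.Rational as ℚ using (ℚ; mkℚ; 0ℚ; 1ℚ; _+_; _*_; _-_; -_; _<_; _≤_; _/_)
  import Data.Rational.Properties as ℚP
  open import Data.Rational.Solver using (module +-*-Solver)
  open import Data.Product using (proj₁; proj₂)
  open import Relation.Binary.PropositionalEquality as Eq using (refl; subst; subst₂; sym; cong)
  open +-*-Solver

  -- The proofs below are kept abstract: they are never computed with, and
  -- unfolding solver-generated proofs during type checking is expensive.
  abstract

    0<diff : ∀ {x y} → x < y → 0ℚ < y - x
    0<diff {x} {y} x<y = subst (_< y - x) (ℚP.+-inverseʳ x) (ℚP.+-monoˡ-< (- x) x<y)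

    0≤diff : ∀ {x y} → x ≤ y → 0ℚ ≤ y - x
    0≤diff {x} {y} x≤y = subst (_≤ y - x) (ℚP.+-inverseʳ x) (ℚP.+-monoˡ-≤ (- x) x≤y)

    <-by-diff : ∀ {x y} d → 0ℚ < d → y - x ≡ d → x < y
    <-by-diff {x} {y} d 0<d y-x≡d = subst₂ _<_ (ℚP.+-identityˡ x) (sub-add x y)
      (ℚP.+-monoˡ-< x (subst (0ℚ <_) (sym y-x≡d) 0<d))
      where
      sub-add : ∀ x y → (y - x) + x ≡ y
      sub-add = solve 2 (λ x y → (y :- x) :+ x := y) refl

    ≤-by-diff : ∀ {x y} d → 0ℚ ≤ d → y - x ≡ d → x ≤ y
    ≤-by-diff {x} {y} d 0≤d y-x≡d = subst₂ _≤_ (ℚP.+-identityˡ x) (sub-add x y)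
      (ℚP.+-monoˡ-≤ x (subst (0ℚ ≤_) (sym y-x≡d) 0≤d))
      where
      sub-add : ∀ x y → (y - x) + x ≡ y
      sub-add = solve 2 (λ x y → (y :- x) :+ x := y) refl

    0<* : ∀ {a b} → 0ℚ < a → 0ℚ < b → 0ℚ < a * b
    0<* {a} {b} 0<a 0<b = ℚP.positive⁻¹ _ {{ℚP.pos*pos⇒pos a {{ℚ.positive 0<a}} b {{ℚ.positive 0<b}}}}

    0≤* : ∀ {a b} → 0ℚ ≤ a → 0ℚ ≤ b → 0ℚ ≤ a * b
    0≤* {a} {b} 0≤a 0≤b =
      ℚP.nonNegative⁻¹ _ {{ℚP.nonNeg*nonNeg⇒nonNeg a {{ℚ.nonNegative 0≤a}} b {{ℚ.nonNegative 0≤b}}}}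

    <+pos : ∀ x {e} → 0ℚ < e → x < x + e
    <+pos x {e} 0<e = <-by-diff e 0<e (solve 2 (λ x e → (x :+ e) :- x := e) refl x e)

    -pos< : ∀ x {e} → 0ℚ < e → x - e < x
    -pos< x {e} 0<e = <-by-diff e 0<e (solve 2 (λ x e → x :- (x :- e) := e) refl x e)

    neg<0 : ∀ {η} → 0ℚ < η → - η < 0ℚ
    neg<0 {η} 0<η = <-by-diff η 0<η (solve 1 (λ η → con 0ℚ :- (:- η) := η) refl η)

    neg-pos : ∀ {σ} → σ < 0ℚ → 0ℚ < - σ
    neg-pos {σ} σ<0 = subst (0ℚ <_) (ℚP.+-identityˡ (- σ)) (0<diff σ<0)

    neg-double< : ∀ {η} → 0ℚ < η → - (η + η) < - η
    neg-double< {η} 0<η = <-by-diff η 0<η (solve 1 (λ η → (:- η) :- (:- (η :+ η)) := η) refl η)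

    <-from-width : ∀ {q r u v} → v - u < r - q → u ≤ q → v < r
    <-from-width {q} {r} {u} {v} thin u≤q = <-by-diff _ (ℚP.+-mono-<-≤ (0<diff thin) (0≤diff u≤q))
      (solve 4 (λ q r u v → r :- v := ((r :- q) :- (v :- u)) :+ (q :- u)) refl q r u v)

    gap-lower : ∀ {α β σ ρ} → α - β < σ - ρ → σ < α → ρ < β
    gap-lower {α} {β} {σ} {ρ} gap σ<α = <-by-diff _ (ℚP.+-mono-< (0<diff gap) (0<diff σ<α))
      (solve 4 (λ α β σ ρ → β :- ρ := ((σ :- ρ) :- (α :- β)) :+ (α :- σ)) refl α β σ ρ)

    gap-upper : ∀ {α β σ ρ} → α - β < ρ - σ → β < σ → α < ρ
    gap-upper {α} {β} {σ} {ρ} gap β<σ = <-by-diff _ (ℚP.+-mono-< (0<diff gap) (0<diff β<σ))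
      (solve 4 (λ α β σ ρ → ρ :- α := ((ρ :- σ) :- (α :- β)) :+ (σ :- β)) refl α β σ ρ)

  fifth quarter half four : ℚ
  fifth   = ℤ.+ 1 / 5
  quarter = ℤ.+ 1 / 4
  half    = ℤ.+ 1 / 2
  four    = ℤ.+ 4 / 1

  -- The slack of [u , v] with respect to δ, used to widen [u , v] on both
  -- sides while keeping its width below δ.
  slack : ℚ → ℚ → ℚ → ℚ
  slack δ u v = (δ - (v - u)) * quarter

  abstract
    0<slack : ∀ {δ u v} → v - u < δ → 0ℚ < slack δ u v
    0<slack v-u<δ = 0<* (0<diff v-u<δ) (ℚP.positive⁻¹ quarter)

    widened< : ∀ {δ u v} → v - u < δ → (v + slack δ u v) - (u - slack δ u v) < δ
    widened< {δ} {u} {v} v-u<δ = <-by-diff _ (0<* (0<diff v-u<δ) (ℚP.positive⁻¹ half))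
      (solve 3 (λ δ u v → δ :- ((v :+ (δ :- (v :- u)) :* con quarter) :- (u :- (δ :- (v :- u)) :* con quarter))
                          := (δ :- (v :- u)) :* con half) refl δ u v)

    quarter-pos : ∀ {σ} → 0ℚ < σ → 0ℚ < σ * quarter
    quarter-pos 0<σ = 0<* 0<σ (ℚP.positive⁻¹ quarter)

    two-quarters< : ∀ {σ} → 0ℚ < σ → σ * quarter + σ * quarter < σ
    two-quarters< {σ} 0<σ = <-by-diff (σ * half) (0<* 0<σ (ℚP.positive⁻¹ half))
      (solve 1 (λ σ → σ :- (σ :* con quarter :+ σ :* con quarter) := σ :* con half) refl σ)

    <-neg-two-quarters : ∀ {σ} → σ < 0ℚ → σ < - ((- σ) * quarter + (- σ) * quarter)
    <-neg-two-quarters {σ} σ<0 = <-by-diff ((- σ) * half) (0<* (neg-pos σ<0) (ℚP.positive⁻¹ half))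
      (solve 1 (λ σ → (:- ((:- σ) :* con quarter :+ (:- σ) :* con quarter)) :- σ := (:- σ) :* con half) refl σ)

  K : ℕ → ℚ
  K n = mkℚ (ℤ.+ (n ℕ.+ 4)) 0 (Coprime.sym (Coprime.1-coprimeTo _))

  abstract
    K-suc : ∀ n → K (suc n) ≡ K n + 1ℚ
    K-suc n = sym (Eq.trans (cong (_/ 1) numerator) (ℚP.normalize-coprime _))
      where
      numerator : ℤ.+ (n ℕ.+ 4) ℤ.* ℤ.+ 1 ℤ.+ ℤ.+ 1 ℤ.* ℤ.+ 1 ≡ ℤ.+ suc (n ℕ.+ 4)
      numerator = Eq.trans (cong (ℤ._+ ℤ.+ 1) (ℤP.*-identityʳ (ℤ.+ (n ℕ.+ 4))))
                           (cong ℤ.+_ (ℕP.+-comm (n ℕ.+ 4) 1))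

    four≤K : ∀ n → four ≤ K n
    four≤K n = ℚ.*≤* (subst₂ ℤ._≤_ (ℤP.pos-* 4 1) (ℤP.pos-* (n ℕ.+ 4) 1)
                        (ℤ.+≤+ (ℕP.*-monoˡ-≤ 1 (ℕP.m≤n+m 4 n))))

    -- A non-negative k / (d + 1) is below k + 4, since k < k + 4 ≤ (k + 4)(d + 1).
    archimedean : (q : ℚ) → Σ ℕ (λ n → q < K n)
    archimedean (mkℚ (ℤ.+ k) d _) = k , ℚ.*<* (subst₂ ℤ._<_ (ℤP.pos-* k 1) (ℤP.pos-* (k ℕ.+ 4) (suc d))
      (ℤ.+<+ (ℕP.<-≤-trans (subst (ℕ._< k ℕ.+ 4) (sym (ℕP.*-identityʳ k)) (ℕP.m<m+n k (ℕ.s≤s ℕ.z≤n)))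
                            (ℕP.m≤m*n (k ℕ.+ 4) (suc d)))))
    archimedean (mkℚ ℤ.-[1+ _ ] _ _) = 0 , ℚ.*<* ℤ.-<+

  mesh : ℚ → ℚ → ℚ
  mesh u v = (v - u) * fifth

  p₁ p₂ p₃ p₄ : ℚ → ℚ → ℚ
  p₁ u v = u + mesh u v
  p₂ u v = p₁ u v + mesh u v
  p₃ u v = p₂ u v + mesh u v
  p₄ u v = p₃ u v + mesh u v

  module _ {u v : ℚ} (u<v : u < v) where
    abstract
      0<mesh : 0ℚ < mesh u v
      0<mesh = 0<* (0<diff u<v) (ℚP.positive⁻¹ fifth)

      u<p₁ : u < p₁ u v
      u<p₁ = <+pos u 0<mesh

      p₁<p₂ : p₁ u v < p₂ u v
      p₁<p₂ = <+pos _ 0<mesh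

      p₂<p₃ : p₂ u v < p₃ u v
      p₂<p₃ = <+pos _ 0<mesh

      p₃<p₄ : p₃ u v < p₄ u v
      p₃<p₄ = <+pos _ 0<mesh

      p₄<v : p₄ u v < v
      p₄<v = <-by-diff (mesh u v) 0<mesh (solve 2 (λ u v →
        v :- ((((u :+ (v :- u) :* con fifth) :+ (v :- u) :* con fifth) :+ (v :- u) :* con fifth)
               :+ (v :- u) :* con fifth)
        := (v :- u) :* con fifth) refl u v)

  data Refines (u v : ℚ) : ℚ → ℚ → Set where
    drop-left  : Refines u v (p₁ u v) v
    drop-right : Refines u v u (p₄ u v)

  abstract
    refines-nested : ∀ {u v u' v'} → u < v → Refines u v u' v' → u ≤ u' × v' ≤ v
    refines-nested u<v drop-left  = ℚP.<⇒≤ (u<p₁ u<v) , ℚP.≤-refl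
    refines-nested u<v drop-right = ℚP.≤-refl , ℚP.<⇒≤ (p₄<v u<v)

    refines-width : ∀ {u v u' v'} → Refines u v u' v' → v' - u' ≡ (v - u) * (four * fifth)
    refines-width {u} {v} drop-left = solve 2 (λ u v →
      v :- (u :+ (v :- u) :* con fifth) := (v :- u) :* (con four :* con fifth)) refl u v
    refines-width {u} {v} drop-right = solve 2 (λ u v →
      ((((u :+ (v :- u) :* con fifth) :+ (v :- u) :* con fifth) :+ (v :- u) :* con fifth)
        :+ (v :- u) :* con fifth) :- u
      := (v :- u) :* (con four :* con fifth)) refl u v

  -- "After n refinements the width w is at most D / (n + 4)".  This bound
  -- survives a contraction by 4/5 because (4/5)(n + 5) ≤ n + 4, and it avoids
  -- powers of 4/5 while still forcing the width below any ε > 0.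
  WidthBound : ℚ → ℕ → ℚ → Set
  WidthBound D n w = w * K n ≤ D

  abstract
    width-bound-step : ∀ {D n w} → 0ℚ ≤ w → WidthBound D n w → WidthBound D (suc n) (w * (four * fifth))
    width-bound-step {D} {n} {w} 0≤w bound = ℚP.≤-trans contraction bound
      where
      contraction : w * (four * fifth) * K (suc n) ≤ w * K n
      contraction rewrite K-suc n =
        ≤-by-diff (w * (K n - four) * fifth) (0≤* (0≤* 0≤w (0≤diff (four≤K n))) (ℚP.nonNegative⁻¹ fifth))
          (solve 2 (λ w k → w :* k :- w :* (con four :* con fifth) :* (k :+ con 1ℚ)
                            := w :* (k :- con four) :* con fifth) refl w (K n))

    refines-bound : ∀ {D n u v u' v'} → u < v → Refines u v u' v' →
                    WidthBound D n (v - u) → WidthBound D (suc n) (v' - u')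
    refines-bound {D} {n} u<v r bound =
      subst (WidthBound D (suc n)) (sym (refines-width r)) (width-bound-step (ℚP.<⇒≤ (0<diff u<v)) bound)

    -- Choose n with D / ε < n + 4; then w ≤ D / (n + 4) < ε.
    width-bound-small : ∀ D ε → 0ℚ < ε → Σ ℕ (λ n → ∀ w → WidthBound D n w → w < ε)
    width-bound-small D ε 0<ε = n , λ w bound → ℚP.*-cancelʳ-<-nonNeg (K n) {{K≥0}} (ℚP.≤-<-trans bound D<εK)
      where
      instance
        ε≢0 : ℚ.NonZero ε
        ε≢0 = ℚP.pos⇒nonZero ε {{ℚ.positive 0<ε}}
      n : ℕ
      n = proj₁ (archimedean (D * ℚ.1/ ε))
      K≥0 : ℚ.NonNegative (K n)
      K≥0 = ℚ.nonNegative (ℚP.≤-trans (ℚP.nonNegative⁻¹ four) (four≤K n))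
      cancel : D * ℚ.1/ ε * ε ≡ D
      cancel = Eq.trans (ℚP.*-assoc D (ℚ.1/ ε) ε) (Eq.trans (cong (D *_) (ℚP.*-inverseˡ ε)) (ℚP.*-identityʳ D))
      D<εK : D < ε * K n
      D<εK = subst₂ _<_ cancel (ℚP.*-comm (K n) ε)
               (ℚP.*-monoˡ-<-pos ε {{ℚ.positive 0<ε}} (proj₂ (archimedean (D * ℚ.1/ ε))))

open RationalArithmetic

module Enumeration where

  open import Data.Nat as ℕ using (ℕ; zero; suc; _+_; _<_)
  import Data.Nat.Properties as ℕP
  open import Data.Bool using (Bool; T)
  open import Data.Bool.Properties using (T-irrelevant)
  import Data.Integer as ℤ
  open import Data.Rational using (ℚ; mkℚ; _/_)
  import Data.Rational.Properties as ℚP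
  open import Data.Product using (proj₁; proj₂)
  open import Data.Sum using (_⊎_; inj₁; inj₂; [_,_]′)
  open import Data.Empty using (⊥-elim)
  open import Relation.Nullary using (¬_; yes; no)
  open import Relation.Nullary.Decidable using (T?; isYes; toWitness; fromWitness)
  open import Relation.Unary using (Decidable)
  open import Relation.Binary using (tri<; tri≈; tri>)
  open import Relation.Binary.PropositionalEquality as Eq using (refl; sym; cong; cong₂)

  Enumeration : Set → Set
  Enumeration A = Σ (ℕ → A) (λ e → ∀ a → Σ ℕ (λ n → e n ≡ a))

  enum-image : ∀ {A B : Set} → Enumeration A → (g : A → B) → (∀ b → Σ A (λ a → g a ≡ b)) → Enumeration B
  enum-image (e , e-onto) g g-onto = (λ n → g (e n)) , onto
    where
    onto : ∀ b → Σ ℕ (λ n → g (e n) ≡ b)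
    onto b = let (a , ga≡b) = g-onto b ; (n , en≡a) = e-onto a in n , Eq.trans (cong g en≡a) ga≡b

  -- Cantor's zigzag through ℕ × ℕ: the diagonal i + j = s is traversed from
  -- (s , 0) to (0 , s), after which the next diagonal starts at (s + 1 , 0).
  zigzag : ℕ × ℕ → ℕ × ℕ
  zigzag (zero  , j) = suc j , 0
  zigzag (suc i , j) = i , suc j

  unpair : ℕ → ℕ × ℕ
  unpair zero    = 0 , 0
  unpair (suc n) = zigzag (unpair n)

  walk : ∀ k i j n → unpair n ≡ (k + i , j) → Σ ℕ (λ m → unpair m ≡ (i , k + j))
  walk zero    i j n visited = n , visited
  walk (suc k) i j n visited =
    let (m , reached) = walk k i (suc j) (suc n) (cong zigzag visited)
    in m , Eq.trans reached (cong (i ,_) (ℕP.+-suc k j))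

  diagonal-start : ∀ s → Σ ℕ (λ n → unpair n ≡ (s , 0))
  diagonal-start zero    = 0 , refl
  diagonal-start (suc s) =
    let (n , start) = diagonal-start s
        (m , end)   = walk s 0 0 n (Eq.trans start (cong (_, 0) (sym (ℕP.+-identityʳ s))))
    in suc m , cong zigzag (Eq.trans end (cong (0 ,_) (ℕP.+-identityʳ s)))

  unpair-onto : ∀ i j → Σ ℕ (λ n → unpair n ≡ (i , j))
  unpair-onto i j =
    let (n , start) = diagonal-start (j + i)
        (m , end)   = walk j i 0 n start
    in m , Eq.trans end (cong (i ,_) (ℕP.+-identityʳ j))

  enum-× : ∀ {A B : Set} → Enumeration A → Enumeration B → Enumeration (A × B)
  enum-× (e , e-onto) (e' , e'-onto) = (λ n → e (proj₁ (unpair n)) , e' (proj₂ (unpair n))) , onto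
    where
    onto : ∀ ab → Σ ℕ (λ n → (e (proj₁ (unpair n)) , e' (proj₂ (unpair n))) ≡ ab)
    onto (a , b) =
      let (i , ei≡a) = e-onto a ; (j , e'j≡b) = e'-onto b ; (n , unpair≡ij) = unpair-onto i j
      in n , cong₂ _,_ (Eq.trans (cong (λ ij → e (proj₁ ij)) unpair≡ij) ei≡a)
                       (Eq.trans (cong (λ ij → e' (proj₂ ij)) unpair≡ij) e'j≡b)

  enum-ℕ : Enumeration ℕ
  enum-ℕ = (λ n → n) , (λ n → n , refl)

  -- An integer is a magnitude together with a sign flag (flag 0: non-negative).
  enum-ℤ : Enumeration ℤ.ℤ
  enum-ℤ = enum-image (enum-× enum-ℕ enum-ℕ) signed onto
    where
    signed : ℕ × ℕ → ℤ.ℤ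
    signed (i , zero)  = ℤ.+ i
    signed (i , suc _) = ℤ.-[1+ i ]
    onto : ∀ z → Σ (ℕ × ℕ) (λ ij → signed ij ≡ z)
    onto (ℤ.+ i)      = (i , 0) , refl
    onto (ℤ.-[1+ i ]) = (i , 1) , refl

  enum-ℚ : Enumeration ℚ
  enum-ℚ = enum-image (enum-× enum-ℤ enum-ℕ) (λ (n , d) → n / suc d) onto
    where
    onto : ∀ q → Σ (ℤ.ℤ × ℕ) (λ (n , d) → n / suc d ≡ q)
    onto q@(mkℚ n d _) = (n , d) , ℚP.↥p/↧p≡p q

  -- Searching an enumerable type for a witness of a decidable property: if a
  -- witness merely exists, one can be computed.  The least index at which the
  -- search succeeds is unique, so the truncation can be eliminated into it.
  module Search (Tr : PropTrunc) (fe : FunExt) where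
    open PropTrunc Tr

    module _ (β : ℕ → Bool) where

      Least : ℕ → Set
      Least n = T (β n) × (∀ m → m < n → ¬ T (β m))

      least-unique : isProp (Σ ℕ Least)
      least-unique (n , t , below) (n' , t' , below') with ℕP.<-cmp n n'
      ... | tri< n<n' _ _ = ⊥-elim (below' n n<n' t)
      ... | tri> _ _ n'<n = ⊥-elim (below n' n'<n t')
      ... | tri≈ _ refl _ = cong₂ (λ t below → n , t , below) (T-irrelevant t t')
                                  (fe λ m → fe λ m<n → fe λ tm → ⊥-elim (below m m<n tm))

      scan : ∀ n → (∀ m → m < n → ¬ T (β m)) ⊎ Σ ℕ Least
      scan zero = inj₁ (λ _ ())
      scan (suc n) with scan n
      ... | inj₂ least = inj₂ least
      ... | inj₁ below with T? (β n)
      ...   | yes t = inj₂ (n , t , below)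
      ...   | no ¬t = inj₁ λ m m<1+n → [ below m , (λ { refl → ¬t }) ]′ (ℕP.m<1+n⇒m<n∨m≡n m<1+n)

      least : ∀ n → T (β n) → Σ ℕ Least
      least n t with scan (suc n)
      ... | inj₂ l     = l
      ... | inj₁ below = ⊥-elim (below n (ℕP.n<1+n n) t)

    search : ∀ {A : Set} → Enumeration A → (P : A → Set) → Decidable P → ∥ Σ A P ∥ → Σ A P
    search (e , e-onto) P P? witness =
      let (n , t , _) = rec (least-unique β) from-witness witness in e n , toWitness {a? = P? (e n)} t
      where
      β : ℕ → Bool
      β n = isYes (P? (e n))
      from-witness : Σ _ P → Σ ℕ (Least β)
      from-witness (a , pa) with e-onto a
      ... | n , refl = least β n (fromWitness {a? = P? (e n)} pa)

open Enumeration

module LocatedReals (Tr : PropTrunc) (fe : FunExt) (pe : PropExt) where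

  open import Data.Nat as ℕ using (ℕ; zero; suc)
  import Data.Nat.Properties as ℕP
  open import Data.Bool using (Bool; true; false; T)
  open import Data.Rational as ℚ using (ℚ; 0ℚ; 1ℚ; _+_; _*_; _-_; -_; _<_; _≤_; _<?_)
  import Data.Rational.Properties as ℚP
  open import Data.Product using (proj₁; proj₂)
  open import Data.Sum using (_⊎_; inj₁; inj₂; swap)
  open import Data.Empty using (⊥; ⊥-elim)
  open import Relation.Nullary using (¬_; yes; no)
  open import Relation.Nullary.Decidable using (Dec; T?; map′; _⊎-dec_)
  open import Relation.Binary.PropositionalEquality using (refl; subst; cong₂)
  open import Axiom.UniquenessOfIdentityProofs.WithK using (uip)
  open Reals Tr
  open Search Tr fe

  <-prop : ∀ {q r} → isProp (q < r)
  <-prop = ℚP.<-irrelevant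

  ⊥-prop : isProp ⊥
  ⊥-prop ()

  L-down : ∀ x {q r} → r <ℚℝ x → q < r → q <ℚℝ x
  L-down x {q} r<x q<r = proj₂ (L-round x q) ∣ _ , q<r , r<x ∣

  U-up : ∀ x {q r} → x <ℝℚ q → q < r → x <ℝℚ r
  U-up x {r = r} x<q q<r = proj₂ (U-round x r) ∣ _ , q<r , x<q ∣

  <ℝ-asym : ∀ x y → x <ℝ y → ¬ (y <ℝ x)
  <ℝ-asym x y x<y y<x = rec ⊥-prop (λ (s , x<s , s<y) → rec ⊥-prop (λ (t , y<t , t<x) →
    ℚP.<-asym (trans x t s t<x x<s) (trans y s t s<y y<t)) y<x) x<y

  compare : ∀ c q r → q < r → (q < c) ⊎ (c < r)
  compare c q r q<r with q <? c
  ... | yes q<c = inj₁ q<c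
  ... | no  q≮c = inj₂ (ℚP.≤-<-trans (ℚP.≮⇒≥ q≮c) q<r)

  ι : ℚ → ℝD
  ι c = record
    { L = λ q → q < c
    ; U = λ r → c < r
    ; L-prop = λ q → <-prop
    ; U-prop = λ r → <-prop
    ; L-inh = ∣ c - 1ℚ , -pos< c (ℚP.positive⁻¹ 1ℚ) ∣
    ; U-inh = ∣ c + 1ℚ , <+pos c (ℚP.positive⁻¹ 1ℚ) ∣
    ; L-round = λ q → (λ q<c → let (m , q<m , m<c) = ℚP.<-dense q<c in ∣ m , q<m , m<c ∣)
                    , rec <-prop (λ (r , q<r , r<c) → ℚP.<-trans q<r r<c)
    ; U-round = λ r → (λ c<r → let (m , c<m , m<r) = ℚP.<-dense c<r in ∣ m , m<r , c<m ∣)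
                    , rec <-prop (λ (q , q<r , c<q) → ℚP.<-trans c<q q<r)
    ; trans = λ q r q<c c<r → ℚP.<-trans q<c c<r
    ; located = λ q r q<r → ∣ compare c q r q<r ∣
    }

  ι-locator : ∀ c → Locator (ι c)
  ι-locator = compare

  ι-< : ∀ {p p'} → p < p' → ι p <ℝ ι p'
  ι-< p<p' = let (m , p<m , m<p') = ℚP.<-dense p<p' in ∣ m , p<m , m<p' ∣

  -- Reals with the same cuts are equal: all other components are propositions.
  ℝ-≡ : (x y : ℝD) → L x ≡ L y → U x ≡ U y → x ≡ y
  ℝ-≡ record { L-prop = lp ; U-prop = up ; L-inh = li ; U-inh = ui
             ; L-round = lr ; U-round = ur ; trans = tr ; located = lo }
      record { L-prop = lp' ; U-prop = up' ; L-inh = li' ; U-inh = ui'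
             ; L-round = lr' ; U-round = ur' ; trans = tr' ; located = lo' }
      refl refl
    with fe (λ q → fe λ a → fe λ b → uip (lp q a b) (lp' q a b))
       | fe (λ r → fe λ a → fe λ b → uip (up r a b) (up' r a b))
       | squash li li' | squash ui ui'
       | fe (λ q → cong₂ _,_ (fe λ a → squash (proj₁ (lr q) a) (proj₁ (lr' q) a))
                             (fe λ b → lp q (proj₂ (lr q) b) (proj₂ (lr' q) b)))
       | fe (λ r → cong₂ _,_ (fe λ a → squash (proj₁ (ur r) a) (proj₁ (ur' r) a))
                             (fe λ b → up r (proj₂ (ur r) b) (proj₂ (ur' r) b)))
       | fe (λ q → fe λ r → fe λ a → fe λ b → <-prop (tr q r a b) (tr' q r a b))
       | fe (λ q → fe λ r → fe λ q<r → squash (lo q r q<r) (lo' q r q<r))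
  ... | refl | refl | refl | refl | refl | refl | refl | refl = refl

  ≤-lower : ∀ x y → x ≤ℝ y → ∀ q → q <ℚℝ x → q <ℚℝ y
  ≤-lower x y x≤y q q<x = rec (L-prop y q) (λ (r , q<r , r<x) →
    rec (L-prop y q) (λ { (inj₁ q<y) → q<y ; (inj₂ y<r) → ⊥-elim (x≤y ∣ r , y<r , r<x ∣) })
      (located y q r q<r)) (proj₁ (L-round x q) q<x)

  ≤-upper : ∀ x y → x ≤ℝ y → ∀ r → y <ℝℚ r → x <ℝℚ r
  ≤-upper x y x≤y r y<r = rec (U-prop x r) (λ (q , q<r , y<q) →
    rec (U-prop x r) (λ { (inj₁ q<x) → ⊥-elim (x≤y ∣ q , y<q , q<x ∣) ; (inj₂ x<r) → x<r })
      (located x q r q<r)) (proj₁ (U-round y r) y<r)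

  ≤-antisym : ∀ {x y} → x ≤ℝ y → y ≤ℝ x → x ≡ y
  ≤-antisym {x} {y} x≤y y≤x =
    ℝ-≡ x y (fe λ q → pe (L-prop x q) (L-prop y q) (≤-lower x y x≤y q) (≤-lower y x y≤x q))
            (fe λ r → pe (U-prop x r) (U-prop y r) (≤-upper y x y≤x r) (≤-upper x y x≤y r))

  _∈[_,_] : ℝD → ℚ → ℚ → Set
  y ∈[ u , v ] = (∀ t → t < u → t <ℚℝ y) × (∀ s → v < s → y <ℝℚ s)

  -- Two reals in a common interval of width less than δ are δ-close: both lie
  -- in the slightly widened open interval (t , s), still of width less than δ.
  ∈-close : ∀ y z {u v δ} → y ∈[ u , v ] → z ∈[ u , v ] → v - u < δ → ∣ y - z ∣< δ
  ∈-close y z {u} {v} {δ} (y-above , y-below) (z-above , z-below) v-u<δ =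
    ∣ (s , t) , y-below s v<s , z-above t t<u , s-t<δ ∣ , ∣ (s , t) , z-below s v<s , y-above t t<u , s-t<δ ∣
    where
    t s : ℚ
    t = u - slack δ u v
    s = v + slack δ u v
    t<u : t < u
    t<u = -pos< u (0<slack {δ} {u} {v} v-u<δ)
    v<s : v < s
    v<s = <+pos v (0<slack {δ} {u} {v} v-u<δ)
    s-t<δ : s - t < δ
    s-t<δ = widened< {δ} {u} {v} v-u<δ

  isLeft : {A B : Set} → A ⊎ B → Bool
  isLeft (inj₁ _) = true
  isLeft (inj₂ _) = false

  left-value : {A B : Set} (s : A ⊎ B) → T (isLeft s) → A
  left-value (inj₁ a) _ = a

  isLeft-unless : {A B : Set} (s : A ⊎ B) → ¬ B → T (isLeft s)
  isLeft-unless (inj₁ _) _  = _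
  isLeft-unless (inj₂ b) ¬b = ¬b b

  -- A located real has (untruncated) rational bounds: search for a rational q
  -- at which the locator, comparing x with q - 1 < q, answers q - 1 < x.
  lower-bound : ∀ x → Locator x → Σ ℚ (_<ℚℝ x)
  lower-bound x ℓ =
    let (q , left) = search enum-ℚ Answers-left (λ q → T? (isLeft (query q))) witness
    in q - 1ℚ , left-value (query q) left
    where
    query : ∀ q → ((q - 1ℚ) <ℚℝ x) ⊎ (x <ℝℚ q)
    query q = ℓ (q - 1ℚ) q (-pos< q (ℚP.positive⁻¹ 1ℚ))
    Answers-left : ℚ → Set
    Answers-left q = T (isLeft (query q))
    witness : ∥ Σ ℚ Answers-left ∥
    witness = rec squash (λ (q , q<x) → ∣ q , isLeft-unless (query q) (λ x<q →
                ℚP.<-irrefl refl (trans x q q q<x x<q)) ∣) (L-inh x)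

  upper-bound : ∀ x → Locator x → Σ ℚ (x <ℝℚ_)
  upper-bound x ℓ =
    let (q , right) = search enum-ℚ Answers-right (λ q → T? (isLeft (swap (query q)))) witness
    in q + 1ℚ , left-value (swap (query q)) right
    where
    query : ∀ q → (q <ℚℝ x) ⊎ (x <ℝℚ (q + 1ℚ))
    query q = ℓ q (q + 1ℚ) (<+pos q (ℚP.positive⁻¹ 1ℚ))
    Answers-right : ℚ → Set
    Answers-right q = T (isLeft (swap (query q)))
    witness : ∥ Σ ℚ Answers-right ∥
    witness = rec squash (λ (q , x<q) → ∣ q , isLeft-unless (swap (query q)) (λ q<x →
                ℚP.<-irrefl refl (trans x q q q<x x<q)) ∣) (U-inh x)

  -- A decidable certificate, read off a locator ℓ of y, that y is apart from 0
  -- at precision η > 0: ℓ, comparing y with η < 2η, answers η < y; or,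
  -- comparing with -2η < -η, answers y < -η.
  module _ (y : ℝD) (ℓ : Locator y) where

    Certifies-sign : (η : ℚ) → 0ℚ < η → Set
    Certifies-sign η 0<η =
      T (isLeft (ℓ η (η + η) (<+pos η 0<η)))
      ⊎ T (isLeft (swap (ℓ (- (η + η)) (- η) (neg-double< 0<η))))

    SignCertificate : ℚ → Set
    SignCertificate η = Σ (0ℚ < η) (Certifies-sign η)

    sign-certificate? : ∀ η → Dec (SignCertificate η)
    sign-certificate? η with 0ℚ <? η
    ... | no  η≯0 = no (λ (0<η , _) → η≯0 0<η)
    ... | yes 0<η = map′ (0<η ,_) (λ (0<η' , c) → subst (Certifies-sign η) (<-prop 0<η' 0<η) c)
                         (T? _ ⊎-dec T? _)

    certificate-sign : ∀ {η} → SignCertificate η → (0ℝ <ℝ y) ⊎ (y <ℝ 0ℝ)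
    certificate-sign {η} (0<η , inj₁ above) =
      inj₁ ∣ η , 0<η , left-value (ℓ η (η + η) _) above ∣
    certificate-sign {η} (0<η , inj₂ below) =
      inj₂ ∣ - η , left-value (swap (ℓ (- (η + η)) (- η) _)) below , neg<0 0<η ∣

    certificate-if-above : ∀ {η} → 0ℚ < η → (η + η) <ℚℝ y → SignCertificate η
    certificate-if-above {η} 0<η 2η<y = 0<η , inj₁ (isLeft-unless (ℓ η (η + η) _)
      (λ y<2η → ℚP.<-irrefl refl (trans y _ _ 2η<y y<2η)))

    certificate-if-below : ∀ {η} → 0ℚ < η → y <ℝℚ (- (η + η)) → SignCertificate η
    certificate-if-below {η} 0<η y<-2η = 0<η , inj₂ (isLeft-unless (swap (ℓ (- (η + η)) (- η) _))
      (λ -2η<y → ℚP.<-irrefl refl (trans y _ _ -2η<y y<-2η)))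

  record Enclosure (z : ℝD) (s s' : ℚ) : Set where
    constructor enclosure
    field
      lo hi : ℚ
      lo<z  : lo <ℚℝ z
      z<hi  : z <ℝℚ hi
      s≤lo  : s ≤ lo
      hi≤s' : hi ≤ s'

  -- Locatedness, applied finitely often to the subdivision points, merely
  -- yields arbitrarily narrow enclosures; so z has rationals arbitrarily near.
  module Approximation (z : ℝD) {s s' : ℚ} (s<z : s <ℚℝ z) (z<s' : z <ℝℚ s') where
    open Enclosure

    initial-width : ℚ
    initial-width = (s' - s) * K 0

    enclosures : ∀ n → ∥ Σ (Enclosure z s s') (λ e → WidthBound initial-width n (hi e - lo e)) ∥
    enclosures zero    = ∣ enclosure s s' s<z z<s' ℚP.≤-refl ℚP.≤-refl , ℚP.≤-refl ∣
    enclosures (suc n) = rec squash refine (enclosures n)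
      where
      refine : Σ (Enclosure z s s') (λ e → WidthBound initial-width n (hi e - lo e)) →
               ∥ Σ (Enclosure z s s') (λ e → WidthBound initial-width (suc n) (hi e - lo e)) ∥
      refine (e , bound) =
        rec squash (λ { (inj₁ p₁<z) → ∣ narrowed drop-left p₁<z (z<hi e) ∣
                      ; (inj₂ z<p₄) → ∣ narrowed drop-right (lo<z e) z<p₄ ∣ })
          (located z _ _ (ℚP.<-trans (p₁<p₂ lo<hi) (ℚP.<-trans (p₂<p₃ lo<hi) (p₃<p₄ lo<hi))))
        where
        lo<hi : lo e < hi e
        lo<hi = trans z _ _ (lo<z e) (z<hi e)
        narrowed : ∀ {u v} → Refines (lo e) (hi e) u v → u <ℚℝ z → z <ℝℚ v →
                   Σ (Enclosure z s s') (λ e → WidthBound initial-width (suc n) (hi e - lo e))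
        narrowed r u<z z<v = let (lo≤u , v≤hi) = refines-nested lo<hi r in
          enclosure _ _ u<z z<v (ℚP.≤-trans (s≤lo e) lo≤u) (ℚP.≤-trans v≤hi (hi≤s' e)) ,
          refines-bound lo<hi r bound

    approximate : ∀ {ε} → 0ℚ < ε → ∥ Σ (Enclosure z s s') (λ e → hi e - lo e < ε) ∥
    approximate {ε} 0<ε = let (n , small) = width-bound-small initial-width ε 0<ε in
      rec squash (λ (e , bound) → ∣ e , small _ bound ∣) (enclosures n)

    rational-near : ∀ {δ} → 0ℚ < δ → ∥ Σ ℚ (λ q → s < q × q < s' × ∣ z - ι q ∣< δ) ∥
    rational-near {δ} 0<δ = rec squash near (approximate 0<δ)
      where
      near : Σ (Enclosure z s s') (λ e → hi e - lo e < δ) → ∥ Σ ℚ (λ q → s < q × q < s' × ∣ z - ι q ∣< δ) ∥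
      near (e , narrow) =
        let (q , lo<q , q<hi) = ℚP.<-dense (trans z _ _ (lo<z e) (z<hi e)) in
        ∣ q , ℚP.≤-<-trans (s≤lo e) lo<q , ℚP.<-≤-trans q<hi (hi≤s' e)
            , ∈-close z (ι q) ((λ t t<lo → L-down z (lo<z e) t<lo) , (λ r hi<r → U-up z (z<hi e) hi<r))
                      ((λ t t<lo → ℚP.<-trans t<lo lo<q) , (λ r hi<r → ℚP.<-trans q<hi hi<r))
                      narrow ∣

  -- Nested rational intervals with widths tending to 0 determine a real, which
  -- comes with a locator: to compare it with q < r, look at an interval
  -- narrower than r - q.
  module NestedIntervals (lo hi : ℕ → ℚ)
      (lo-mono : ∀ n → lo n ≤ lo (suc n)) (hi-mono : ∀ n → hi (suc n) ≤ hi n)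
      (lo<hi : ∀ n → lo n < hi n) (narrow : ∀ {ε} → 0ℚ < ε → Σ ℕ (λ n → hi n - lo n < ε)) where

    lo-up : ∀ k n → lo n ≤ lo (k ℕ.+ n)
    lo-up zero    n = ℚP.≤-refl
    lo-up (suc k) n = ℚP.≤-trans (lo-up k n) (lo-mono (k ℕ.+ n))

    hi-down : ∀ k n → hi (k ℕ.+ n) ≤ hi n
    hi-down zero    n = ℚP.≤-refl
    hi-down (suc k) n = ℚP.≤-trans (hi-mono (k ℕ.+ n)) (hi-down k n)

    lo<hi-any : ∀ m n → lo m < hi n
    lo<hi-any m n = ℚP.≤-<-trans (lo-up n m) (ℚP.<-≤-trans (lo<hi (n ℕ.+ m))
                      (subst (λ k → hi k ≤ hi n) (ℕP.+-comm m n) (hi-down m n)))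

    Lower Upper : ℚ → Set
    Lower q = ∃∥ ℕ (λ n → q < lo n)
    Upper r = ∃∥ ℕ (λ n → hi n < r)

    locate : ∀ q r → q < r → Lower q ⊎ Upper r
    locate q r q<r with narrow (0<diff q<r)
    ... | N , thin with q <? lo N
    ...   | yes q<lo = inj₁ ∣ N , q<lo ∣
    ...   | no  q≮lo = inj₂ ∣ N , <-from-width thin (ℚP.≮⇒≥ q≮lo) ∣

    limit : ℝD
    limit = record
      { L = Lower
      ; U = Upper
      ; L-prop = λ q → squash
      ; U-prop = λ r → squash
      ; L-inh = ∣ lo 0 - 1ℚ , ∣ 0 , -pos< (lo 0) (ℚP.positive⁻¹ 1ℚ) ∣ ∣
      ; U-inh = ∣ hi 0 + 1ℚ , ∣ 0 , <+pos (hi 0) (ℚP.positive⁻¹ 1ℚ) ∣ ∣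
      ; L-round = λ q →
          rec squash (λ (n , q<lo) → let (m , q<m , m<lo) = ℚP.<-dense q<lo in ∣ m , q<m , ∣ n , m<lo ∣ ∣)
          , rec squash (λ (r , q<r , r-lower) →
              rec squash (λ (n , r<lo) → ∣ n , ℚP.<-trans q<r r<lo ∣) r-lower)
      ; U-round = λ r →
          rec squash (λ (n , hi<r) → let (m , hi<m , m<r) = ℚP.<-dense hi<r in ∣ m , m<r , ∣ n , hi<m ∣ ∣)
          , rec squash (λ (q , q<r , q-upper) →
              rec squash (λ (n , hi<q) → ∣ n , ℚP.<-trans hi<q q<r ∣) q-upper)
      ; trans = λ q r q-lower r-upper → rec <-prop (λ (m , q<lo) → rec <-prop (λ (n , hi<r) →
                  ℚP.<-trans (ℚP.<-trans q<lo (lo<hi-any m n)) hi<r) r-upper) q-lower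
      ; located = λ q r q<r → ∣ locate q r q<r ∣
      }

    limit-locator : Locator limit
    limit-locator = locate

    limit-∈ : ∀ n → limit ∈[ lo n , hi n ]
    limit-∈ n = (λ t t<lo → ∣ n , t<lo ∣) , (λ s hi<s → ∣ n , hi<s ∣)

  module _ (f : ℝD → ℝD) (f-cont : PointwiseContinuous f) where

    lower-persists : ∀ x {σ ρ} → ρ < σ → σ <ℚℝ f x →
                     ∃∥ ℚ₊ (λ δ → ∀ y → ∣ x - y ∣< proj₁ δ → ρ <ℚℝ f y)
    lower-persists x {σ} {ρ} ρ<σ σ<fx =
      rec squash (λ (δ , near) → ∣ δ , (λ y x≈y → rec (L-prop (f y) ρ) (bound y) (proj₁ (near y x≈y))) ∣)
        (f-cont x (σ - ρ , 0<diff ρ<σ))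
      where
      bound : ∀ y → Σ (ℚ × ℚ) (λ (α , β) → (f x <ℝℚ α) × (β <ℚℝ f y) × (α - β < σ - ρ)) → ρ <ℚℝ f y
      bound y ((α , β) , fx<α , β<fy , gap) = L-down (f y) β<fy (gap-lower gap (trans (f x) σ α σ<fx fx<α))

    upper-persists : ∀ x {σ ρ} → σ < ρ → f x <ℝℚ σ →
                     ∃∥ ℚ₊ (λ δ → ∀ y → ∣ x - y ∣< proj₁ δ → f y <ℝℚ ρ)
    upper-persists x {σ} {ρ} σ<ρ fx<σ =
      rec squash (λ (δ , near) → ∣ δ , (λ y x≈y → rec (U-prop (f y) ρ) (bound y) (proj₂ (near y x≈y))) ∣)
        (f-cont x (ρ - σ , 0<diff σ<ρ))
      where
      bound : ∀ y → Σ (ℚ × ℚ) (λ (α , β) → (f y <ℝℚ α) × (β <ℚℝ f x) × (α - β < ρ - σ)) → f y <ℝℚ ρ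
      bound y ((α , β) , fy<α , β<fx , gap) = U-up (f y) fy<α (gap-upper gap (trans (f x) β σ β<fx fx<σ))

module IntermediateValue (Tr : PropTrunc) (fe : FunExt) (pe : PropExt) where

  open import Data.Nat as ℕ using (ℕ; zero; suc)
  open import Data.Rational as ℚ using (ℚ; 0ℚ; _+_; _*_; _-_; -_; _<_; _<?_)
  import Data.Rational.Properties as ℚP
  open import Data.Product using (proj₁; proj₂)
  open import Data.Sum using (_⊎_; inj₁; inj₂; [_,_]′)
  open import Data.Empty using (⊥-elim)
  open import Function using (id)
  open import Relation.Nullary.Decidable using (_×-dec_)
  open import Relation.Unary using (Decidable)
  open import Relation.Binary.PropositionalEquality using (refl)
  open Reals Tr
  open Search Tr fe
  open LocatedReals Tr fe pe

  module Root (f : ℝD → ℝD) (f-cont : PointwiseContinuous f) (f-nonconst : LocallyNonconstant f)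
              (f-lifts : LiftsLocators f) where

    locator-at : ∀ q → Locator (f (ι q))
    locator-at q = f-lifts (ι q) (ι-locator q)

    Signed : ℚ → ℚ → ℚ × ℚ → Set
    Signed p p' (q , η) = (p < q) × (q < p') × SignCertificate (f (ι q)) (locator-at q) η

    signed? : ∀ p p' → Decidable (Signed p p')
    signed? p p' (q , η) = p <? q ×-dec q <? p' ×-dec sign-certificate? (f (ι q)) (locator-at q) η

    rational-witness : ∀ {p p' z} (P : ℝD → Set) → ι p <ℝ z → z <ℝ ι p' →
                       ∃∥ ℚ₊ (λ δ → ∀ y → ∣ z - y ∣< proj₁ δ → P y) →
                       ∥ Σ ℚ (λ q → (p < q) × (q < p') × P (ι q)) ∥
    rational-witness {p} {p'} {z} P p<z z<p' nearby =
      rec squash (λ (s , p<s , s<z) → rec squash (λ (s' , z<s' , s'<p') → rec squash (λ (δ , near⇒P) →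
        rec squash (λ (q , s<q , q<s' , z≈q) →
          ∣ q , ℚP.<-trans p<s s<q , ℚP.<-trans q<s' s'<p' , near⇒P (ι q) z≈q ∣)
          (Approximation.rational-near z s<z z<s' (proj₂ δ))) nearby) z<p') p<z

    -- Local nonconstancy makes f apart from 0 at some z ∈ (p , p'); by
    -- continuity f keeps a definite sign near z, hence at a nearby rational,
    -- where the locator of f then certifies it.
    signed-exists : ∀ {p p'} → p < p' → ∥ Σ (ℚ × ℚ) (Signed p p') ∥
    signed-exists {p} {p'} p<p' = rec squash apart (f-nonconst (ι p) (ι p') (ι-< p<p') 0ℝ)
      where
      apart : Σ ℝD (λ z → (ι p <ℝ z) × (z <ℝ ι p') × (f z # 0ℝ)) → ∥ Σ (ℚ × ℚ) (Signed p p') ∥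
      apart (z , p<z , z<p' , fz#0) = rec squash (λ { (inj₁ fz<0) → negative fz<0 ; (inj₂ 0<fz) → positive 0<fz }) fz#0
        where
        positive : 0ℝ <ℝ f z → ∥ Σ (ℚ × ℚ) (Signed p p') ∥
        positive = rec squash λ (σ , 0<σ , σ<fz) →
          let η = σ * quarter in
          rec squash (λ (q , p<q , q<p' , 2η<fq) →
            ∣ (q , η) , p<q , q<p' , certificate-if-above (f (ι q)) (locator-at q) (quarter-pos 0<σ) 2η<fq ∣)
            (rational-witness {p} {p'} {z} (λ y → (η + η) <ℚℝ f y) p<z z<p'
              (lower-persists f f-cont z (two-quarters< 0<σ) σ<fz))
        negative : f z <ℝ 0ℝ → ∥ Σ (ℚ × ℚ) (Signed p p') ∥
        negative = rec squash λ (σ , fz<σ , σ<0) →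
          let η = (- σ) * quarter in
          rec squash (λ (q , p<q , q<p' , fq<-2η) →
            ∣ (q , η) , p<q , q<p' , certificate-if-below (f (ι q)) (locator-at q) (quarter-pos (neg-pos σ<0)) fq<-2η ∣)
            (rational-witness {p} {p'} {z} (λ y → f y <ℝℚ (- (η + η))) p<z z<p'
              (upper-persists f f-cont z (<-neg-two-quarters σ<0) fz<σ))

    SignPoint : ℚ → ℚ → Set
    SignPoint p p' = Σ ℚ (λ q → (p < q) × (q < p') × ((0ℝ <ℝ f (ι q)) ⊎ (f (ι q) <ℝ 0ℝ)))

    sign-point : ∀ {p p'} → p < p' → SignPoint p p'
    sign-point {p} {p'} p<p' =
      let ((q , η) , p<q , q<p' , certificate) =
            search (enum-× enum-ℚ enum-ℚ) (Signed p p') (signed? p p') (signed-exists p<p')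
      in q , p<q , q<p' , certificate-sign (f (ι q)) (locator-at q) certificate

    record Bracket : Set₁ where
      field
        A B   : ℝD
        A-loc : Locator A
        B-loc : Locator B
        fA≤0  : f A ≤ℝ 0ℝ
        0≤fB  : 0ℝ ≤ℝ f B
        u v   : ℚ
        u<A   : u <ℚℝ A
        B<v   : B <ℝℚ v
        A≲B   : ∀ q r → q <ℚℝ A → B <ℝℚ r → q < r

      u<v : u < v
      u<v = A≲B u v u<A B<v

      -- Both endpoints lie in [u , v]; for the outer bounds the locators of
      -- A and B combine with A ≲ B.
      A-∈ : A ∈[ u , v ]
      A-∈ = (λ t t<u → L-down A u<A t<u)
          , (λ s v<s → [ (λ v<A → ⊥-elim (ℚP.<-irrefl refl (A≲B v v v<A B<v))) , id ]′
                         (A-loc v s v<s))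

      B-∈ : B ∈[ u , v ]
      B-∈ = (λ t t<u → [ id , (λ B<u → ⊥-elim (ℚP.<-irrefl refl (A≲B u u u<A B<u))) ]′
                         (B-loc t u t<u))
          , (λ s v<s → U-up B B<v v<s)
    open Bracket

    Step : Bracket → Set₁
    Step s = Σ Bracket (λ s' → Refines (u s) (v s) (u s') (v s'))

    insert-point : (s : Bracket) → p₃ (u s) (v s) <ℚℝ B s → A s <ℝℚ p₂ (u s) (v s) →
                   SignPoint (p₂ (u s) (v s)) (p₃ (u s) (v s)) → Step s
    insert-point s p₃<B A<p₂ (q , p₂<q , q<p₃ , inj₁ 0<fq) =
      record s { B = ι q ; B-loc = ι-locator q ; 0≤fB = <ℝ-asym 0ℝ (f (ι q)) 0<fq
               ; v = p₄ (u s) (v s) ; B<v = ℚP.<-trans q<p₃ (p₃<p₄ (u<v s))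
               ; A≲B = λ t r t<A q<r → ℚP.<-trans (ℚP.<-trans (trans (A s) t _ t<A A<p₂) p₂<q) q<r }
      , drop-right
    insert-point s p₃<B A<p₂ (q , p₂<q , q<p₃ , inj₂ fq<0) =
      record s { A = ι q ; A-loc = ι-locator q ; fA≤0 = <ℝ-asym (f (ι q)) 0ℝ fq<0
               ; u = p₁ (u s) (v s) ; u<A = ℚP.<-trans (p₁<p₂ (u<v s)) p₂<q
               ; A≲B = λ t r t<q B<r → ℚP.<-trans (ℚP.<-trans t<q q<p₃) (trans (B s) _ r p₃<B B<r) }
      , drop-left

    step : (s : Bracket) → Step s
    step s with B-loc s (p₃ (u s) (v s)) (p₄ (u s) (v s)) (p₃<p₄ (u<v s))
    ... | inj₂ B<p₄ = record s { v = p₄ (u s) (v s) ; B<v = B<p₄ } , drop-right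
    ... | inj₁ p₃<B with A-loc s (p₁ (u s) (v s)) (p₂ (u s) (v s)) (p₁<p₂ (u<v s))
    ...   | inj₁ p₁<A = record s { u = p₁ (u s) (v s) ; u<A = p₁<A } , drop-left
    ...   | inj₂ A<p₂ = insert-point s p₃<B A<p₂ (sign-point (p₂<p₃ (u<v s)))

    initial-bracket : (a b : ℝD) → Locator a → Locator b → a <ℝ b → f a ≤ℝ 0ℝ → 0ℝ ≤ℝ f b → Bracket
    initial-bracket a b a-loc b-loc a<b fa≤0 0≤fb = record
      { A = a ; B = b ; A-loc = a-loc ; B-loc = b-loc ; fA≤0 = fa≤0 ; 0≤fB = 0≤fb
      ; u = proj₁ (lower-bound a a-loc) ; v = proj₁ (upper-bound b b-loc)
      ; u<A = proj₂ (lower-bound a a-loc) ; B<v = proj₂ (upper-bound b b-loc)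
      ; A≲B = λ q r q<a b<r → rec <-prop (λ (s , a<s , s<b) →
                ℚP.<-trans (trans a q s q<a a<s) (trans b s r s<b b<r)) a<b
      }

    module Bisection (initial : Bracket) where

      bracket : ℕ → Bracket
      bracket zero    = initial
      bracket (suc n) = proj₁ (step (bracket n))

      lo hi : ℕ → ℚ
      lo n = u (bracket n)
      hi n = v (bracket n)

      refines : ∀ n → Refines (lo n) (hi n) (lo (suc n)) (hi (suc n))
      refines n = proj₂ (step (bracket n))

      width-bound : ∀ n → WidthBound ((hi 0 - lo 0) * K 0) n (hi n - lo n)
      width-bound zero    = ℚP.≤-refl
      width-bound (suc n) = refines-bound (u<v (bracket n)) (refines n) (width-bound n)

      narrow : ∀ {ε} → 0ℚ < ε → Σ ℕ (λ n → hi n - lo n < ε)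
      narrow {ε} 0<ε = let (n , small) = width-bound-small _ ε 0<ε in n , small _ (width-bound n)

      open NestedIntervals lo hi
        (λ n → proj₁ (refines-nested (u<v (bracket n)) (refines n)))
        (λ n → proj₂ (refines-nested (u<v (bracket n)) (refines n)))
        (λ n → u<v (bracket n)) narrow
        public

      root : ℝD
      root = limit

      endpoints-near : ∀ {δ} → 0ℚ < δ →
                       Σ ℕ (λ n → ∣ root - A (bracket n) ∣< δ × ∣ root - B (bracket n) ∣< δ)
      endpoints-near 0<δ = let (n , thin) = narrow 0<δ in
        n , ∈-close root (A (bracket n)) (limit-∈ n) (A-∈ (bracket n)) thin
          , ∈-close root (B (bracket n)) (limit-∈ n) (B-∈ (bracket n)) thin

      -- If f root > σ > ρ > 0, continuity gives f A > ρ for a bracket close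
      -- enough to the root, contradicting f A ≤ 0.  Symmetrically for B.
      f-root≤0 : f root ≤ℝ 0ℝ
      f-root≤0 = rec ⊥-prop λ (σ , 0<σ , σ<f-root) →
        let (ρ , 0<ρ , ρ<σ) = ℚP.<-dense 0<σ in
        rec ⊥-prop (λ ((δ , 0<δ) , near) → let (n , A≈root , _) = endpoints-near 0<δ in
            fA≤0 (bracket n) ∣ ρ , 0<ρ , near (A (bracket n)) A≈root ∣)
          (lower-persists f f-cont root ρ<σ σ<f-root)

      0≤f-root : 0ℝ ≤ℝ f root
      0≤f-root = rec ⊥-prop λ (σ , f-root<σ , σ<0) →
        let (ρ , σ<ρ , ρ<0) = ℚP.<-dense σ<0 in
        rec ⊥-prop (λ ((δ , 0<δ) , near) → let (n , _ , B≈root) = endpoints-near 0<δ in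
            0≤fB (bracket n) ∣ ρ , near (B (bracket n)) B≈root , ρ<0 ∣)
          (upper-persists f f-cont root σ<ρ f-root<σ)

      f-root≡0 : f root ≡ 0ℝ
      f-root≡0 = ≤-antisym f-root≤0 0≤f-root


theorem4p16 : (T : PropTrunc) → FunExt → PropExt →
    let open Reals T in
    (f : ℝD → ℝD) → PointwiseContinuous f → LocallyNonconstant f → LiftsLocators f →
    (a b : ℝD) → Locator a → Locator b → a <ℝ b →
    f a ≤ℝ 0ℝ → 0ℝ ≤ℝ f b →
    Σ ℝD (λ x → (f x ≡ 0ℝ) × Locator x)
theorem4p16 T fe pe f f-cont f-nonconst f-lifts a b a-loc b-loc a<b fa≤0 0≤fb =
  root , f-root≡0 , limit-locator
  where
  open IntermediateValue T fe pe
  open Root f f-cont f-nonconst f-lifts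
  open Bisection (initial-bracket a b a-loc b-loc a<b fa≤0 0≤fb)
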